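{- Let $(f,C)$ be a low-defect pair. Then: (1) If $f$ is a constant $n$ and $C=\|n\|$, then $(f,C)$ is substantial if and only if $n$ is stable. (2) If $f=g_1\otimes g_2$ and $C=D_1+D_2$, where $(g_1,D_1),(g_2,D_2)$ are low-defect pairs, $a$ is the leading coefficient of $f$ and $b_i$ is the leading coefficient of $g_i$, then $(f,C)$ is substantial if and only if $(g_1,D_1)$ and $(g_2,D_2)$ are substantial, $a$ is stable, and $\|a\|=\|b_1\|+\|b_2\|$. (3) If $f=g\otimes x+c$ (i.e. $g$ times a new variable $x$, plus the constant $c\in\mathbb{N}$) and $C=D+\|c\|$, where $(g,D)$ is a low-defect pair, then $(f,C)$ is substantial if and only if $(g,D)$ is substantial and $c=1$.
   Context: $\|n\|$ denotes the integer complexity of $n\in\mathbb{N}$ (least number of $1$'s needed to write $n$ using $1$, $+$, $\cdot$ and parentheses). $n$ is stable if $\|3^kn\|=3k+\|n\|$ for all $k\ge0$; the stable complexity is $\|n\|_{\mathrm{st}}=\|3^kn\|-3k$ for any $k$ with $3^kn$ stable. Low-defect pairs: the smallest subset $\mathscr{P}$ of $\mathbb{Z}[x_1,x_2,\ldots]\times\mathbb{N}$ such that (i) $(k,C)\in\mathscr{P}$ for constant $k\in\mathbb{N}$ and $C\ge\|k\|$; (ii) $(f_1,C_1),(f_2,C_2)\in\mathscr{P}$ implies $(f_1\otimes f_2,C_1+C_2)\in\mathscr{P}$, where $f_1\otimes f_2$ denotes the product of $f_1$ and $f_2$ after relabeling their variables to be disjoint; (iii) $(f,C)\in\mathscr{P}$,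 $c\in\mathbb{N}$, $D\ge\|c\|$ imply $(f\otimes x+c,C+D)\in\mathscr{P}$, with $x$ a new variable. A low-defect polynomial is multilinear, its degree equals its number of variables, and its leading coefficient (coefficient of the product of all variables) is nonzero. A pair $(f,C)$ with leading coefficient $a$ is substantial if $C=\|a\|_{\mathrm{st}}+\deg f$. -}

module Defs where

open import Data.Nat using (ℕ; zero; suc; _+_; _*_; _^_; _≤_)
open import Data.Bool using (Bool; true; false; if_then_else_; _∧_; not)
open import Data.Fin using (Fin; zero; suc; _↑ˡ_; _↑ʳ_; fromℕ; inject₁)
open import Data.Fin.Permutation using (Permutation′; _⟨$⟩ʳ_)
open import Data.Product using (Σ; _×_)
open import Relation.Binary.PropositionalEquality using (_≡_)

data Expr : Set where
  one : Expr
  _⊕_ : Expr → Expr → Expr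
  _⊛_ : Expr → Expr → Expr

eval : Expr → ℕ
eval one = 1
eval (e ⊕ e′) = eval e + eval e′
eval (e ⊛ e′) = eval e * eval e′

ones : Expr → ℕ
ones one = 1
ones (e ⊕ e′) = ones e + ones e′
ones (e ⊛ e′) = ones e + ones e′

‖_‖≡_ : ℕ → ℕ → Set
‖ n ‖≡ k = (Σ Expr λ e → eval e ≡ n × ones e ≡ k)
         × (∀ e → eval e ≡ n → k ≤ ones e)

Stable : ℕ → Set
Stable n = ∀ k m → ‖ n ‖≡ m → ‖ 3 ^ k * n ‖≡ (3 * k + m)

‖_‖st≡_ : ℕ → ℕ → Set
‖ n ‖st≡ s = Σ ℕ λ k → Stable (3 ^ k * n) × ‖ 3 ^ k * n ‖≡ (s + 3 * k)

-- Multilinear polynomials with ℕ coefficients in d variables x_0..x_{d-1}: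
-- a monomial is a subset of the variables, a polynomial its coefficient map.

Mono : ℕ → Set
Mono d = Fin d → Bool

Poly : ℕ → Set
Poly d = Mono d → ℕ

_≈_ : ∀ {d} → Poly d → Poly d → Set
f ≈ g = ∀ S → f S ≡ g S

constP : ℕ → Poly 0
constP n _ = n

-- f₁ ⊗ f₂ : product, variables of f₁ first, then those of f₂ (disjoint)
_⊗_ : ∀ {d₁ d₂} → Poly d₁ → Poly d₂ → Poly (d₁ + d₂)
_⊗_ {d₁} {d₂} f g S = f (λ i → S (i ↑ˡ d₂)) * g (λ j → S (d₁ ↑ʳ j))

isEmpty : ∀ {d} → Mono d → Bool
isEmpty {zero} S = true
isEmpty {suc d} S = not (S zero) ∧ isEmpty (λ i → S (suc i))

-- f ⊗x+ c : f times a new (last) variable x, plus the constant c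
_⊗x+_ : ∀ {d} → Poly d → ℕ → Poly (suc d)
_⊗x+_ {d} f c S =
  if S (fromℕ d) then f (λ i → S (inject₁ i))
  else (if isEmpty (λ i → S (inject₁ i)) then c else 0)

rename : ∀ {d} → Permutation′ d → Poly d → Poly d
rename σ f S = f (λ i → S (σ ⟨$⟩ʳ i))

-- leading coefficient: coefficient of the product of all variables
full : ∀ {d} → Mono d
full _ = true

lc : ∀ {d} → Poly d → ℕ
lc f = f full

-- degree = number of variables (as for low-defect polynomials)
deg : ∀ {d} → Poly d → ℕ
deg {d} _ = d

data LowDefect : ∀ {d} → Poly d → ℕ → Set where
  ld-const : ∀ {f : Poly 0} {C} k m →
             ‖ k ‖≡ m → m ≤ C → f ≈ constP k → LowDefect f C
  ld-mul   : ∀ {d₁ d₂} {f : Poly (d₁ + d₂)} {g₁ : Poly d₁} {g₂ : Poly d₂} {C₁ C₂} →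
             LowDefect g₁ C₁ → LowDefect g₂ C₂ → f ≈ (g₁ ⊗ g₂) →
             LowDefect f (C₁ + C₂)
  ld-lin   : ∀ {d} {f : Poly (suc d)} {g : Poly d} {C} c m D →
             LowDefect g C → ‖ c ‖≡ m → m ≤ D → f ≈ (g ⊗x+ c) →
             LowDefect f (C + D)
  ld-rename : ∀ {d} {f g : Poly d} {C} (σ : Permutation′ d) →
             LowDefect g C → f ≈ rename σ g → LowDefect f C

Substantial : ∀ {d} → Poly d → ℕ → Set
Substantial f C = Σ ℕ λ s → ‖ lc f ‖st≡ s × C ≡ s + deg f

module Submission where

-- For a low-defect pair (f , C) with leading coefficient a, an expression for a can be read
-- off the construction of f, so ‖a‖ + deg f ≤ C; always ‖a‖st ≤ ‖a‖. Substantiality says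
-- that C meets the lower bound ‖a‖st + deg f, so every inequality along the construction is
-- tight. Tightness at a product forces ‖a‖ = ‖b₁‖ + ‖b₂‖ and, by cancelling a factor in the
-- bound ‖a‖st ≥ ‖b₁‖ + ‖b₂‖, stability of a, b₁ and b₂; tightness at g ⊗ x + c forces
-- ‖c‖ = 1, i.e. c = 1. Conversely, ‖b₁ b₂‖st ≤ ‖b₁‖st + ‖b₂‖st turns the product conditions
-- back into C = ‖a‖st + deg f. Throughout, n is recognised as stable by "‖n‖ ≤ ‖n‖st".

open import Defs
open import Data.Nat using (ℕ; zero; suc; _+_; _*_; _^_; _≤_; z≤n; s≤s)
open import Data.Nat.Properties
open import Data.Nat.Tactic.RingSolver using (solve-∀)
open import Data.Product using (Σ; _×_; _,_; proj₁; proj₂)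
open import Function.Bundles using (_⇔_; mk⇔; Equivalence)
open import Relation.Binary.PropositionalEquality
open import Relation.Nullary using (contradiction)

ones-pos : ∀ e → 1 ≤ ones e
ones-pos one     = s≤s z≤n
ones-pos (e ⊕ _) = ≤-trans (ones-pos e) (m≤m+n _ _)
ones-pos (e ⊛ _) = ≤-trans (ones-pos e) (m≤m+n _ _)

‖‖≡-pos : ∀ {n m} → ‖ n ‖≡ m → 1 ≤ m
‖‖≡-pos ((e , _ , refl) , _) = ones-pos e

‖‖≡-unique : ∀ {n m m′} → ‖ n ‖≡ m → ‖ n ‖≡ m′ → m ≡ m′
‖‖≡-unique ((e , ev , refl) , min) ((e′ , ev′ , refl) , min′) =
  ≤-antisym (min e′ ev′) (min′ e ev)

‖1‖≡1 : ‖ 1 ‖≡ 1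
‖1‖≡1 = (one , refl , refl) , λ e _ → ones-pos e

‖‖≡1⇒≡1 : ∀ {n} → ‖ n ‖≡ 1 → n ≡ 1
‖‖≡1⇒≡1 ((e , refl , ones≡1) , _) = eval≡1 e ones≡1
  where
  sum≢1 : ∀ e e′ → ones e + ones e′ ≢ 1
  sum≢1 e e′ eq = <⇒≢ (+-mono-≤ (ones-pos e) (ones-pos e′)) (sym eq)
  eval≡1 : ∀ e → ones e ≡ 1 → eval e ≡ 1
  eval≡1 one      _  = refl
  eval≡1 (e ⊕ e′) eq = contradiction eq (sum≢1 e e′)
  eval≡1 (e ⊛ e′) eq = contradiction eq (sum≢1 e e′)

times3^ : ℕ → Expr → Expr
times3^ zero    e = e
times3^ (suc k) e = (one ⊕ (one ⊕ one)) ⊛ times3^ k e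

eval-times3^ : ∀ k e → eval (times3^ k e) ≡ 3 ^ k * eval e
eval-times3^ zero    e = sym (*-identityˡ (eval e))
eval-times3^ (suc k) e = trans (cong (3 *_) (eval-times3^ k e)) (sym (*-assoc 3 (3 ^ k) (eval e)))

ones-times3^ : ∀ k e → ones (times3^ k e) ≡ 3 * k + ones e
ones-times3^ zero    e = refl
ones-times3^ (suc k) e = trans (cong (3 +_) (ones-times3^ k e)) (shift k (ones e))
  where
  shift : ∀ k x → 3 + (3 * k + x) ≡ 3 * suc k + x
  shift = solve-∀

-- Since ‖3ʲ n‖ − 3j is non-increasing in j with limit ‖n‖st, this says s ≤ ‖n‖st.
infix 4 _≤‖_‖st
_≤‖_‖st : ℕ → ℕ → Set
s ≤‖ n ‖st = ∀ j e → eval e ≡ 3 ^ j * n → s + 3 * j ≤ ones e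

≤‖‖st⇒≤ones : ∀ {s n} → s ≤‖ n ‖st → ∀ e → eval e ≡ n → s ≤ ones e
≤‖‖st⇒≤ones {s} {n} bound e refl =
  subst (_≤ ones e) (+-identityʳ s) (bound 0 e (sym (*-identityˡ n)))

≤‖‖st-attained⇒‖‖≡ : ∀ {n} e → eval e ≡ n → ones e ≤‖ n ‖st → ‖ n ‖≡ ones e
≤‖‖st-attained⇒‖‖≡ e ev bound = (e , ev , refl) , ≤‖‖st⇒≤ones bound

stable⇔≤‖‖st : ∀ {n m} → ‖ n ‖≡ m → Stable n ⇔ m ≤‖ n ‖st
stable⇔≤‖‖st {n} {m} hm@((e , refl , refl) , _) = mk⇔ stable⇒bound bound⇒stable
  where
  stable⇒bound : Stable n → m ≤‖ n ‖st
  stable⇒bound stable j e′ ev′ =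
    subst (_≤ ones e′) (+-comm (3 * j) m) (proj₂ (stable j m hm) e′ ev′)
  bound⇒stable : m ≤‖ n ‖st → Stable n
  bound⇒stable bound k m′ hm′ rewrite ‖‖≡-unique hm′ hm =
    (times3^ k e , eval-times3^ k e , ones-times3^ k e) ,
    λ e′ ev′ → subst (_≤ ones e′) (+-comm m (3 * k)) (bound k e′ ev′)

≤‖‖st-attained⇒stable : ∀ {n} e → eval e ≡ n → ones e ≤‖ n ‖st → Stable n
≤‖‖st-attained⇒stable e ev bound =
  Equivalence.from (stable⇔≤‖‖st (≤‖‖st-attained⇒‖‖≡ e ev bound)) bound

stable⇒‖‖st≡ : ∀ {n m} → Stable n → ‖ n ‖≡ m → ‖ n ‖st≡ m
stable⇒‖‖st≡ {n} {m} stable hm =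
  0 , subst Stable (sym (*-identityˡ n)) stable ,
  subst₂ ‖_‖≡_ (sym (*-identityˡ n)) (sym (+-identityʳ m)) hm

-- An expression e for 3ʲ n gives the expression 3ᵏ·e for 3ʲ (3ᵏ n).
≤‖3^*‖st-cancel : ∀ {s k n} → (s + 3 * k) ≤‖ 3 ^ k * n ‖st → s ≤‖ n ‖st
≤‖3^*‖st-cancel {s} {k} {n} bound j e ev =
  +-cancelˡ-≤ (3 * k) (s + 3 * j) (ones e)
    (subst₂ _≤_ (reorder s k j) (ones-times3^ k e)
      (bound j (times3^ k e)
        (trans (eval-times3^ k e) (trans (cong (3 ^ k *_) ev) (swap (3 ^ k) (3 ^ j) n)))))
  where
  reorder : ∀ s k j → s + 3 * k + 3 * j ≡ 3 * k + (s + 3 * j)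
  reorder = solve-∀
  swap : ∀ x y n → x * (y * n) ≡ y * (x * n)
  swap = solve-∀

‖‖st≡⇒≤‖‖st : ∀ {n s} → ‖ n ‖st≡ s → s ≤‖ n ‖st
‖‖st≡⇒≤‖‖st {n} {s} (k , stable , hk) =
  ≤‖3^*‖st-cancel {s} {k} {n} (Equivalence.to (stable⇔≤‖‖st {3 ^ k * n} hk) stable)

‖‖st≤‖‖ : ∀ {n s m} → ‖ n ‖st≡ s → ‖ n ‖≡ m → s ≤ m
‖‖st≤‖‖ {n} {s} st ((e , ev , refl) , _) = ≤‖‖st⇒≤ones (‖‖st≡⇒≤‖‖st {n} {s} st) e ev

≤‖*‖st-cancelʳ : ∀ {m s n} e → eval e ≡ m → (s + ones e) ≤‖ n * m ‖st → s ≤‖ n ‖st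
≤‖*‖st-cancelʳ {m} {s} {n} e refl bound j e′ ev′ =
  +-cancelʳ-≤ (ones e) (s + 3 * j) (ones e′)
    (subst (_≤ ones e′ + ones e) (reorder s (ones e) j)
      (bound j (e′ ⊛ e) (trans (cong (_* m) ev′) (*-assoc (3 ^ j) n m))))
  where
  reorder : ∀ s t j → s + t + 3 * j ≡ s + 3 * j + t
  reorder = solve-∀

≤‖*‖st-cancelˡ : ∀ {m s n} e → eval e ≡ m → (ones e + s) ≤‖ m * n ‖st → s ≤‖ n ‖st
≤‖*‖st-cancelˡ {m} {s} {n} e ev bound =
  ≤‖*‖st-cancelʳ {m} {s} {n} e ev (subst₂ _≤‖_‖st (+-comm (ones e) s) (*-comm m n) bound)

≤‖*‖st⇒≤+ : ∀ {m s n t k} → ‖ m ‖st≡ s → ‖ n ‖st≡ t → k ≤‖ m * n ‖st → k ≤ s + t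
≤‖*‖st⇒≤+ {m} {s} {n} {t} {k} (i , _ , (e , ev , on) , _) (j , _ , (e′ , ev′ , on′) , _) bound =
  +-cancelʳ-≤ (3 * (i + j)) k (s + t)
    (subst (k + 3 * (i + j) ≤_) (trans (cong₂ _+_ on on′) (reorder s t i j))
      (bound (i + j) (e ⊛ e′) (trans (cong₂ _*_ ev ev′) powers)))
  where
  reorder : ∀ s t i j → s + 3 * i + (t + 3 * j) ≡ s + t + 3 * (i + j)
  reorder = solve-∀
  regroup : ∀ x y m n → x * m * (y * n) ≡ x * y * (m * n)
  regroup = solve-∀
  powers : 3 ^ i * m * (3 ^ j * n) ≡ 3 ^ (i + j) * (m * n)
  powers = trans (regroup (3 ^ i) (3 ^ j) m n) (cong (_* (m * n)) (sym (^-distribˡ-+-* 3 i j)))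

+-tight : ∀ {a b A B} → a ≤ A → b ≤ B → A + B ≤ a + b → A ≡ a × B ≡ b
+-tight {a} {b} {A} {B} a≤A b≤B sum≤ =
  ≤-antisym (+-cancelʳ-≤ b A a (≤-trans (+-monoʳ-≤ A b≤B) sum≤)) a≤A ,
  ≤-antisym (+-cancelˡ-≤ a B b (≤-trans (+-monoˡ-≤ B a≤A) sum≤)) b≤B

interchange : ∀ a b c d → (a + c) + (b + d) ≡ (a + b) + (c + d)
interchange = solve-∀

lowDefect⇒lcExpr : ∀ {d} {f : Poly d} {C} → LowDefect f C →
                   Σ Expr λ e → eval e ≡ lc f × ones e + d ≤ C
lowDefect⇒lcExpr {f = f} (ld-const k m ((e , ev , refl) , _) m≤C f≈) =
  e , trans ev (sym (f≈ full)) , subst (_≤ _) (sym (+-identityʳ (ones e))) m≤C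
lowDefect⇒lcExpr {f = f} (ld-mul {d₁} {d₂} {C₁ = C₁} {C₂} g₁ g₂ f≈)
  with lowDefect⇒lcExpr g₁ | lowDefect⇒lcExpr g₂
... | e₁ , ev₁ , le₁ | e₂ , ev₂ , le₂ =
  e₁ ⊛ e₂ , trans (cong₂ _*_ ev₁ ev₂) (sym (f≈ full)) ,
  subst (_≤ C₁ + C₂) (interchange (ones e₁) (ones e₂) d₁ d₂) (+-mono-≤ le₁ le₂)
lowDefect⇒lcExpr {f = f} (ld-lin {d} {C = C} c m D g ‖c‖≡m m≤D f≈) with lowDefect⇒lcExpr g
... | e , ev , le =
  e , trans ev (sym (f≈ full)) ,
  subst (_≤ C + D) (trans (+-comm (ones e + d) 1) (sym (+-suc (ones e) d)))
    (+-mono-≤ le (≤-trans (‖‖≡-pos ‖c‖≡m) m≤D))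
lowDefect⇒lcExpr {f = f} (ld-rename σ g f≈) with lowDefect⇒lcExpr g
... | e , ev , le = e , trans ev (sym (f≈ full)) , le

lowDefect-‖‖st-bound : ∀ {d} {f : Poly d} {C s} → LowDefect f C → ‖ lc f ‖st≡ s → s + d ≤ C
lowDefect-‖‖st-bound {d} {f} {C} {s} ld st with lowDefect⇒lcExpr ld
... | e , ev , le = ≤-trans (+-monoˡ-≤ d (≤‖‖st⇒≤ones (‖‖st≡⇒≤‖‖st {lc f} {s} st) e ev)) le

substantial-const⇔stable : ∀ (f : Poly 0) (C n : ℕ) → LowDefect f C → f ≈ constP n →
                           ‖ n ‖≡ C → Substantial f C ⇔ Stable n
substantial-const⇔stable f C n _ f≈ hC = mk⇔ to from
  where
  to : Substantial f C → Stable n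
  to (s , st , C≡s+0) =
    Equivalence.from (stable⇔≤‖‖st hC)
      (subst₂ _≤‖_‖st (sym (trans C≡s+0 (+-identityʳ s))) (f≈ full) (‖‖st≡⇒≤‖‖st {lc f} {s} st))
  from : Stable n → Substantial f C
  from stable = C , subst (‖_‖st≡ C) (sym (f≈ full)) (stable⇒‖‖st≡ stable hC) , sym (+-identityʳ C)

SubstantialFactors : ∀ {d₁ d₂} → Poly (d₁ + d₂) → Poly d₁ → Poly d₂ → ℕ → ℕ → Set
SubstantialFactors f g₁ g₂ D₁ D₂ =
  Substantial g₁ D₁ × Substantial g₂ D₂ × Stable (lc f) ×
  Σ ℕ λ m₁ → Σ ℕ λ m₂ → ‖ lc g₁ ‖≡ m₁ × ‖ lc g₂ ‖≡ m₂ × ‖ lc f ‖≡ (m₁ + m₂)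

substantial-⊗⇒ : ∀ {d₁ d₂} {f : Poly (d₁ + d₂)} {g₁ : Poly d₁} {g₂ : Poly d₂} {D₁ D₂} →
                 LowDefect g₁ D₁ → LowDefect g₂ D₂ → f ≈ (g₁ ⊗ g₂) →
                 Substantial f (D₁ + D₂) → SubstantialFactors f g₁ g₂ D₁ D₂
substantial-⊗⇒ {d₁} {d₂} {f} {g₁} {g₂} {D₁} {D₂} ld₁ ld₂ f≈ (s , st , D≡)
  with lowDefect⇒lcExpr ld₁ | lowDefect⇒lcExpr ld₂
... | e₁ , ev₁ , le₁ | e₂ , ev₂ , le₂ =
  (ones e₁ , stable⇒‖‖st≡ (≤‖‖st-attained⇒stable e₁ ev₁ bound₁) ‖b₁‖ , D₁≡) ,
  (ones e₂ , stable⇒‖‖st≡ (≤‖‖st-attained⇒stable e₂ ev₂ bound₂) ‖b₂‖ , D₂≡) ,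
  ≤‖‖st-attained⇒stable (e₁ ⊛ e₂) ev bound , ones e₁ , ones e₂ , ‖b₁‖ , ‖b₂‖ , ‖a‖
  where
  ev : eval (e₁ ⊛ e₂) ≡ lc f
  ev = trans (cong₂ _*_ ev₁ ev₂) (sym (f≈ full))
  s≤ : s ≤ ones e₁ + ones e₂
  s≤ = ≤‖‖st⇒≤ones (‖‖st≡⇒≤‖‖st {lc f} {s} st) (e₁ ⊛ e₂) ev
  open ≤-Reasoning
  D₁≡×D₂≡ : D₁ ≡ ones e₁ + d₁ × D₂ ≡ ones e₂ + d₂
  D₁≡×D₂≡ = +-tight le₁ le₂ (begin
    D₁ + D₂                          ≡⟨ D≡ ⟩
    s + (d₁ + d₂)                    ≤⟨ +-monoˡ-≤ (d₁ + d₂) s≤ ⟩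
    ones e₁ + ones e₂ + (d₁ + d₂)    ≡⟨ interchange (ones e₁) (ones e₂) d₁ d₂ ⟨
    ones e₁ + d₁ + (ones e₂ + d₂)    ∎)
  D₁≡ = proj₁ D₁≡×D₂≡
  D₂≡ = proj₂ D₁≡×D₂≡
  s≡ : s ≡ ones e₁ + ones e₂
  s≡ = +-cancelʳ-≡ (d₁ + d₂) s (ones e₁ + ones e₂)
         (trans (sym D≡) (trans (cong₂ _+_ D₁≡ D₂≡) (interchange (ones e₁) (ones e₂) d₁ d₂)))
  bound : ones (e₁ ⊛ e₂) ≤‖ lc f ‖st
  bound = subst (_≤‖ lc f ‖st) s≡ (‖‖st≡⇒≤‖‖st {lc f} {s} st)
  bound-b₁b₂ : ones e₁ + ones e₂ ≤‖ lc g₁ * lc g₂ ‖st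
  bound-b₁b₂ = subst (ones (e₁ ⊛ e₂) ≤‖_‖st) (f≈ full) bound
  bound₁ : ones e₁ ≤‖ lc g₁ ‖st
  bound₁ = ≤‖*‖st-cancelʳ {s = ones e₁} {lc g₁} e₂ ev₂ bound-b₁b₂
  bound₂ : ones e₂ ≤‖ lc g₂ ‖st
  bound₂ = ≤‖*‖st-cancelˡ {s = ones e₂} {lc g₂} e₁ ev₁ bound-b₁b₂
  ‖b₁‖ = ≤‖‖st-attained⇒‖‖≡ e₁ ev₁ bound₁
  ‖b₂‖ = ≤‖‖st-attained⇒‖‖≡ e₂ ev₂ bound₂
  ‖a‖ = ≤‖‖st-attained⇒‖‖≡ (e₁ ⊛ e₂) ev bound

substantial-⊗⇐ : ∀ {d₁ d₂} {f : Poly (d₁ + d₂)} {g₁ : Poly d₁} {g₂ : Poly d₂} {D₁ D₂} →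
                 f ≈ (g₁ ⊗ g₂) → SubstantialFactors f g₁ g₂ D₁ D₂ → Substantial f (D₁ + D₂)
substantial-⊗⇐ {d₁} {d₂} {f} {g₁} {g₂} {D₁} {D₂} f≈
  ((s₁ , st₁ , D₁≡) , (s₂ , st₂ , D₂≡) , stable , m₁ , m₂ , ‖b₁‖ , ‖b₂‖ , ‖a‖) =
  m₁ + m₂ , stable⇒‖‖st≡ stable ‖a‖ , (begin
    D₁ + D₂                  ≡⟨ cong₂ _+_ D₁≡ D₂≡ ⟩
    s₁ + d₁ + (s₂ + d₂)      ≡⟨ interchange s₁ s₂ d₁ d₂ ⟩
    s₁ + s₂ + (d₁ + d₂)      ≡⟨ cong (_+ (d₁ + d₂)) s₁+s₂≡m₁+m₂ ⟩
    m₁ + m₂ + (d₁ + d₂)      ∎)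
  where
  open ≡-Reasoning
  bound : m₁ + m₂ ≤‖ lc g₁ * lc g₂ ‖st
  bound = subst (m₁ + m₂ ≤‖_‖st) (f≈ full) (Equivalence.to (stable⇔≤‖‖st {lc f} ‖a‖) stable)
  s₁+s₂≡m₁+m₂ : s₁ + s₂ ≡ m₁ + m₂
  s₁+s₂≡m₁+m₂ = ≤-antisym
    (+-mono-≤ (‖‖st≤‖‖ {lc g₁} {s₁} st₁ ‖b₁‖) (‖‖st≤‖‖ {lc g₂} {s₂} st₂ ‖b₂‖))
    (≤‖*‖st⇒≤+ {lc g₁} {s₁} {lc g₂} {s₂} st₁ st₂ bound)

substantial-⊗⇔ : ∀ {d₁ d₂} (f : Poly (d₁ + d₂)) (g₁ : Poly d₁) (g₂ : Poly d₂) (C D₁ D₂ : ℕ) →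
                 LowDefect f C → LowDefect g₁ D₁ → LowDefect g₂ D₂ →
                 f ≈ (g₁ ⊗ g₂) → C ≡ D₁ + D₂ →
                 Substantial f C ⇔ SubstantialFactors f g₁ g₂ D₁ D₂
substantial-⊗⇔ f g₁ g₂ C D₁ D₂ _ ld₁ ld₂ f≈ refl =
  mk⇔ (substantial-⊗⇒ ld₁ ld₂ f≈) (substantial-⊗⇐ {g₁ = g₁} {g₂} f≈)

substantial-⊗x+⇔ : ∀ {d} (f : Poly (suc d)) (g : Poly d) (C D c m : ℕ) →
                   LowDefect f C → LowDefect g D → f ≈ (g ⊗x+ c) →
                   ‖ c ‖≡ m → C ≡ D + m →
                   Substantial f C ⇔ (Substantial g D × c ≡ 1)
substantial-⊗x+⇔ {d} f g C D c m _ ld f≈ ‖c‖ refl = mk⇔ to from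
  where
  to : Substantial f (D + m) → Substantial g D × c ≡ 1
  to (s , st , D+m≡) = (s , st′ , proj₁ tight) , ‖‖≡1⇒≡1 (subst (‖ c ‖≡_) (proj₂ tight) ‖c‖)
    where
    st′ : ‖ lc g ‖st≡ s
    st′ = subst (‖_‖st≡ s) (f≈ full) st
    tight : D ≡ s + d × m ≡ 1
    tight = +-tight (lowDefect-‖‖st-bound {f = g} ld st′) (‖‖≡-pos {c} {m} ‖c‖)
              (≤-reflexive (trans D+m≡ (trans (+-suc s d) (+-comm 1 (s + d)))))
  from : Substantial g D × c ≡ 1 → Substantial f (D + m)
  from ((s , st , D≡) , refl) =
    s , subst (‖_‖st≡ s) (sym (f≈ full)) st ,
    trans (cong₂ _+_ D≡ (‖‖≡-unique ‖c‖ ‖1‖≡1)) (trans (+-comm (s + d) 1) (sym (+-suc s d)))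

proposition3p5 :
    (∀ (f : Poly 0) (C n : ℕ) → LowDefect f C → f ≈ constP n → ‖ n ‖≡ C →
       (Substantial f C ⇔ Stable n))
    ×
    (∀ {d₁ d₂} (f : Poly (d₁ + d₂)) (g₁ : Poly d₁) (g₂ : Poly d₂) (C D₁ D₂ : ℕ) →
       LowDefect f C → LowDefect g₁ D₁ → LowDefect g₂ D₂ →
       f ≈ (g₁ ⊗ g₂) → C ≡ D₁ + D₂ →
       (Substantial f C ⇔
         (Substantial g₁ D₁ × Substantial g₂ D₂ × Stable (lc f) ×
          Σ ℕ λ m₁ → Σ ℕ λ m₂ →
            ‖ lc g₁ ‖≡ m₁ × ‖ lc g₂ ‖≡ m₂ × ‖ lc f ‖≡ (m₁ + m₂))))
    ×
    (∀ {d} (f : Poly (suc d)) (g : Poly d) (C D c m : ℕ) →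
       LowDefect f C → LowDefect g D → f ≈ (g ⊗x+ c) →
       ‖ c ‖≡ m → C ≡ D + m →
       (Substantial f C ⇔ (Substantial g D × c ≡ 1)))
proposition3p5 = substantial-const⇔stable , substantial-⊗⇔ , substantial-⊗x+⇔
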